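{- Let $\mathsf{L}\subset X\times Y\times Z$ be a latin square of order $n$. Let $f\in L^2(X^n)$, $g\in L^2(Y^n)$, $h\in L^2(Z^n)$ and $A,B,C\subset[n]$. Then $\Lambda(P_Af,P_Bg,P_Ch)=0$ unless $A=B=C$.
   Context: A latin square of order $n$ is $\mathsf{L}\subset X\times Y\times Z$ with $|X|=|Y|=|Z|=n$ such that every pair in $X\times Y$, $Y\times Z$, $Z\times X$ lies in exactly one triple. $\mathsf{L}^n\subset X^n\times Y^n\times Z^n$ is the set of $(x,y,z)$ with $(x_i,y_i,z_i)\in\mathsf{L}$ for all $i$, and $\Lambda(f,g,h)=\mathbf{E}_{(x,y,z)\in\mathsf{L}^n}f(x)g(y)h(z)$. $L^2(X^n)$ is the space of functions $X^n\to\mathbf{C}$ with inner product $\mathbf{E}_{x\in X^n}f(x)\overline{g(x)}$. For $A\subset[n]$, $Q_A$ is the orthogonal projection onto functions depending only on $(x_i:i\in A)$, and $P_A=\sum_{B\subset A}(-1)^{|A\setminus B|}Q_B$; equivalently $P_A$ is the orthogonal projection onto the space of functions depending only on $(x_i:i\in A)$ whose average over $x_i$ (other coordinates fixed) vanishes for every $i\in A$. The same definitions apply on $Y^n$ and $Z^n$. -}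

module Defs where

open import Level using (Level; _⊔_) renaming (suc to lsuc)
open import Algebra.Bundles using (CommutativeRing)
open import Data.Nat as ℕ using (ℕ; zero; suc)
open import Data.Fin using (Fin; zero; suc; _≟_)
open import Data.Fin.Subset using (Subset; inside; outside; _─_; ∣_∣)
open import Data.Fin.Subset.Properties using (_∈?_; _⊆?_)
open import Data.Fin.Properties using (all?)
open import Data.Vec using ([]; _∷_)
open import Data.Vec.Functional using () renaming (_∷_ to _∷ᶠ_)
open import Data.Bool using (Bool; true; false; if_then_else_)
open import Data.Product using (∃!)
open import Relation.Nullary using (Dec; ¬_)
open import Relation.Nullary.Decidable using (_→-dec_; ⌊_⌋)
open import Relation.Binary.PropositionalEquality using (_≡_)

record LatinSquare (n : ℕ) : Set₁ where
  field
    L    : Fin n → Fin n → Fin n → Set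
    L?   : ∀ x y z → Dec (L x y z)
    uniqXY : ∀ x y → ∃! _≡_ (λ z → L x y z)
    uniqYZ : ∀ y z → ∃! _≡_ (λ x → L x y z)
    uniqZX : ∀ z x → ∃! _≡_ (λ y → L x y z)

-- Scalars: a commutative ring in which every nonzero natural number is
-- invertible (a Q-algebra, e.g. the complex numbers).

natR : ∀ {c ℓ} (R : CommutativeRing c ℓ) → ℕ → CommutativeRing.Carrier R
natR R zero    = CommutativeRing.0# R
natR R (suc m) = CommutativeRing._+_ R (CommutativeRing.1# R) (natR R m)

record Scalars (c ℓ : Level) : Set (lsuc (c ⊔ ℓ)) where
  field
    scalarRing : CommutativeRing c ℓ
  open CommutativeRing scalarRing
  field
    inv     : ℕ → Carrier
    inv-law : ∀ m → ¬ (m ≡ 0) → (natR scalarRing m * inv m) ≈ 1#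

sumFin : ∀ {a} {A : Set a} → (A → A → A) → A → ∀ {m} → (Fin m → A) → A
sumFin _⊕_ e {zero}  F = e
sumFin _⊕_ e {suc m} F = F zero ⊕ sumFin _⊕_ e (λ i → F (suc i))

sumPts : ∀ {a} {A : Set a} → (A → A → A) → A → ∀ k {m} → ((Fin k → Fin m) → A) → A
sumPts _⊕_ e zero    F = F (λ ())
sumPts _⊕_ e (suc k) F = sumFin _⊕_ e (λ a → sumPts _⊕_ e k (λ v → F (a ∷ᶠ v)))

sumSub : ∀ {a} {A : Set a} → (A → A → A) → A → ∀ k → (Subset k → A) → A
sumSub _⊕_ e zero    F = F []
sumSub _⊕_ e (suc k) F =
  sumSub _⊕_ e k (λ B → F (inside ∷ B)) ⊕ sumSub _⊕_ e k (λ B → F (outside ∷ B))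

module _ {c ℓ} (S : Scalars c ℓ) where
  open Scalars S
  open CommutativeRing scalarRing

  Fun : ℕ → Set c
  Fun n = (Fin n → Fin n) → Carrier

  ind : Bool → Carrier
  ind b = if b then 1# else 0#

  sign : ℕ → Carrier
  sign zero    = 1#
  sign (suc k) = - (sign k)

  avg : ∀ n → ((Fin n → Fin n) → Bool) → Fun n → Carrier
  avg n p F = sumPts _+_ 0# n (λ x → ind (p x) * F x)
              * inv (sumPts ℕ._+_ 0 n (λ x → if p x then 1 else 0))

  agree : ∀ {n} → Subset n → (Fin n → Fin n) → (Fin n → Fin n) → Bool
  agree B x x' = ⌊ all? (λ i → (i ∈? B) →-dec (x i ≟ x' i)) ⌋

  Q : ∀ {n} → Subset n → Fun n → Fun n
  Q {n} B f x = avg n (agree B x) f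

  P : ∀ {n} → Subset n → Fun n → Fun n
  P {n} A f x = sumSub _+_ 0# n
    (λ B → ind ⌊ B ⊆? A ⌋ * (sign ∣ A ─ B ∣ * Q B f x))

  inLn : ∀ {n} → LatinSquare n → (Fin n → Fin n) → (Fin n → Fin n) → (Fin n → Fin n) → Bool
  inLn Ls x y z = ⌊ all? (λ i → LatinSquare.L? Ls (x i) (y i) (z i)) ⌋

  Λ : ∀ {n} → LatinSquare n → Fun n → Fun n → Fun n → Carrier
  Λ {n} Ls f g h =
    sumPts _+_ 0# n (λ x → sumPts _+_ 0# n (λ y → sumPts _+_ 0# n (λ z →
      ind (inLn Ls x y z) * (f x * (g y * h z)))))
    * inv (sumPts ℕ._+_ 0 n (λ x → sumPts ℕ._+_ 0 n (λ y → sumPts ℕ._+_ 0 n (λ z →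
      if inLn Ls x y z then 1 else 0))))

  _≈S_ : Carrier → Carrier → Set ℓ
  _≈S_ = _≈_

  0S : Carrier
  0S = 0#

{-# OPTIONS --safe #-}
module Submission where

-- Choose a coordinate i at which the indicator vectors of A, B, C are not all equal.
-- Along coordinate i, P_A f has mean zero when i ∈ A (in the sum defining P_A, the
-- terms for T ∪ {i} and T cancel: they carry opposite signs, and averaging over x_i
-- turns Q_{T ∪ {i}} into Q_T), and it does not depend on x_i when i ∉ A.
-- Splitting L^n as L^(n-1) × L at coordinate i writes Λ as a combination of
-- one-coordinate forms Σ_{(a,b,c) ∈ L} F a · G b · H c. Because L is a latin square,
-- such a form factors into a product of sums once one of F, G, H is constant, so it
-- vanishes when another one of them has mean zero.

open import Defs
open import Level using (Level; _⊔_)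
open import Algebra.Bundles using (CommutativeSemiring; CommutativeRing)
open import Data.Bool using (Bool; true; false; _∧_; if_then_else_)
import Data.Bool.Properties as Boolₚ
open import Data.Nat as ℕ using (ℕ; zero; suc)
import Data.Nat.Properties as ℕₚ
open import Data.Fin using (Fin; zero; suc; punchIn; punchOut; _≟_)
open import Data.Fin.Properties using (punchIn-punchOut; punchInᵢ≢i; all?; ¬∀⟶∃¬)
open import Data.Fin.Subset using (Subset; inside; outside; _∈_; _⊆_; _─_; ∣_∣)
open import Data.Fin.Subset.Properties using (_∈?_; _⊆?_)
open import Data.Product using (_×_; _,_; proj₁; proj₂; ∃; ∃!)
open import Data.Empty using (⊥-elim)
open import Data.Sum using ([_,_]′)
open import Data.Vec as Vec using (Vec; []; _∷_; lookup)
open import Data.Vec.Properties as Vecₚ using ([]=⇒lookup; lookup⇒[]=)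
open import Data.Vec.Functional as Vector using (Vector; head; tail)
open import Data.Vec.Functional.Properties using (insertAt-lookup; insertAt-punchIn)
open import Function using (id; _∘_; _⇔_; mk⇔; Equivalence)
open import Function.Construct.Composition using (_⇔-∘_)
open import Relation.Nullary using (Dec; yes; no; ¬_)
open import Relation.Nullary.Decidable using (⌊_⌋; _×-dec_; _→-dec_; isYes≗does; does-⇔)
open import Relation.Binary.PropositionalEquality as ≡ using (_≡_; _≢_; _≗_; refl; subst)

private
  variable
    a p : Level
    A : Set a
    k N : ℕ

∀-punchIn : ∀ {P : Fin (suc k) → Set p} (i : Fin (suc k)) →
            (∀ t → P t) ⇔ (P i × ∀ t → P (punchIn i t))
∀-punchIn {P = P} i = mk⇔ (λ ∀P → ∀P i , ∀P ∘ punchIn i) from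
  where
  from : P i × (∀ t → P (punchIn i t)) → ∀ t → P t
  from (Pi , Pi′) t with i ≟ t
  ... | yes refl = Pi
  ... | no i≢t   = subst P (punchIn-punchOut i≢t) (Pi′ (punchOut i≢t))

-- Unlike Data.Vec.Functional.insertAt, this is built from _∷_, so that sumPts unfolds
-- along it definitionally; this matters because functions on points need not respect _≗_.
insertAt′ : Vector A k → Fin (suc k) → A → Vector A (suc k)
insertAt′             xs zero    v = v Vector.∷ xs
insertAt′ {k = suc k} xs (suc i) v = head xs Vector.∷ insertAt′ (tail xs) i v

insertAt′≗insertAt : (xs : Vector A k) (i : Fin (suc k)) (v : A) →
                     insertAt′ xs i v ≗ Vector.insertAt xs i v
insertAt′≗insertAt             xs zero    v zero    = refl
insertAt′≗insertAt             xs zero    v (suc t) = refl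
insertAt′≗insertAt {k = suc k} xs (suc i) v zero    = refl
insertAt′≗insertAt {k = suc k} xs (suc i) v (suc t) = insertAt′≗insertAt (tail xs) i v t

insertAt′-lookup : (xs : Vector A k) (i : Fin (suc k)) (v : A) → insertAt′ xs i v i ≡ v
insertAt′-lookup xs i v = ≡.trans (insertAt′≗insertAt xs i v i) (insertAt-lookup xs i v)

insertAt′-punchIn : (xs : Vector A k) (i : Fin (suc k)) (v : A) (t : Fin k) →
                    insertAt′ xs i v (punchIn i t) ≡ xs t
insertAt′-punchIn xs i v t = ≡.trans (insertAt′≗insertAt xs i v _) (insertAt-punchIn xs i v t)

⌊⌋-⇔ : ∀ {b} {B : Set b} → A ⇔ B → (a? : Dec A) (b? : Dec B) → ⌊ a? ⌋ ≡ ⌊ b? ⌋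
⌊⌋-⇔ A⇔B a? b? = ≡.trans (isYes≗does a?) (≡.trans (does-⇔ A⇔B a? b?) (≡.sym (isYes≗does b?)))

⌊⌋-×-dec : ∀ {b} {B : Set b} (a? : Dec A) (b? : Dec B) → ⌊ a? ×-dec b? ⌋ ≡ ⌊ a? ⌋ ∧ ⌊ b? ⌋
⌊⌋-×-dec a? b? =
  ≡.trans (isYes≗does (a? ×-dec b?)) (≡.sym (≡.cong₂ _∧_ (isYes≗does a?) (isYes≗does b?)))

→-≡-⇔ : ∀ {b} {X Y : Set b} {u u′ v v′ : A} → X ⇔ Y → u ≡ u′ → v ≡ v′ →
        (X → u ≡ v) ⇔ (Y → u′ ≡ v′)
→-≡-⇔ X⇔Y refl refl = mk⇔ (λ h → h ∘ Equivalence.from X⇔Y) (λ h → h ∘ Equivalence.to X⇔Y)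

∈⇔lookup : ∀ {t : Fin k} {S : Subset k} → t ∈ S ⇔ lookup S t ≡ inside
∈⇔lookup {t = t} {S} = mk⇔ []=⇒lookup (lookup⇒[]= t S)

∈-insertAt-here : ∀ (S : Subset k) i {s} → i ∈ Vec.insertAt S i s ⇔ s ≡ inside
∈-insertAt-here S i {s} = mk⇔
  (λ i∈ → ≡.trans (≡.sym (Vecₚ.insertAt-lookup S i s)) (Equivalence.to ∈⇔lookup i∈))
  (λ s≡ → Equivalence.from ∈⇔lookup (≡.trans (Vecₚ.insertAt-lookup S i s) s≡))

∈-insertAt-punchIn : ∀ (S : Subset k) i {s} t → punchIn i t ∈ Vec.insertAt S i s ⇔ t ∈ S
∈-insertAt-punchIn S i {s} t = mk⇔
  (λ t∈ → Equivalence.from ∈⇔lookup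
            (≡.trans (≡.sym (Vecₚ.insertAt-punchIn S i s t)) (Equivalence.to ∈⇔lookup t∈)))
  (λ t∈ → Equivalence.from ∈⇔lookup (≡.trans (Vecₚ.insertAt-punchIn S i s t) (Equivalence.to ∈⇔lookup t∈)))

insertAt-⊆-insertAt : ∀ (S A : Subset k) i s → Vec.insertAt S i s ⊆ Vec.insertAt A i inside ⇔ S ⊆ A
insertAt-⊆-insertAt S A i s = mk⇔
  (λ S′⊆A′ {t} t∈ → Equivalence.to (∈-insertAt-punchIn A i t)
                       (S′⊆A′ (Equivalence.from (∈-insertAt-punchIn S i t) t∈)))
  (λ S⊆A {t} → Equivalence.from (∀-punchIn {P = λ t → t ∈ S′ → t ∈ A′} i)
     ( (λ _ → Equivalence.from (∈-insertAt-here A i) refl)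
     , (λ t t∈ → Equivalence.from (∈-insertAt-punchIn A i t)
                   (S⊆A (Equivalence.to (∈-insertAt-punchIn S i t) t∈)))) t)
  where
  S′ = Vec.insertAt S i s
  A′ = Vec.insertAt A i inside

insertAt-⊈-insertAt : ∀ (S A : Subset k) i → ¬ (Vec.insertAt S i inside ⊆ Vec.insertAt A i outside)
insertAt-⊈-insertAt S A i S′⊆A′
  with () ← Equivalence.to (∈-insertAt-here A i) (S′⊆A′ (Equivalence.from (∈-insertAt-here S i) refl))

∣insertAt─insertAt∣ : ∀ (A S : Subset k) i s →
  ∣ Vec.insertAt A i inside ─ Vec.insertAt S i s ∣ ≡ (if s then 0 else 1) ℕ.+ ∣ A ─ S ∣
∣insertAt─insertAt∣ A             S             zero    inside  = refl
∣insertAt─insertAt∣ A             S             zero    outside = refl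
∣insertAt─insertAt∣ (_ ∷ A)       (inside  ∷ S) (suc i) s       = ∣insertAt─insertAt∣ A S i s
∣insertAt─insertAt∣ (outside ∷ A) (outside ∷ S) (suc i) s       = ∣insertAt─insertAt∣ A S i s
∣insertAt─insertAt∣ (inside  ∷ A) (outside ∷ S) (suc i) s       =
  ≡.trans (≡.cong suc (∣insertAt─insertAt∣ A S i s)) (≡.sym (ℕₚ.+-suc _ ∣ A ─ S ∣))

lookup-ext : {xs ys : Vec A k} → lookup xs ≗ lookup ys → xs ≡ ys
lookup-ext {xs = xs} {ys} eq =
  ≡.trans (≡.sym (Vecₚ.tabulate∘lookup xs)) (≡.trans (Vecₚ.tabulate-cong eq) (Vecₚ.tabulate∘lookup ys))

differing-coordinate : ∀ {A B C : Subset k} → ¬ (A ≡ B × B ≡ C) →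
                       ∃ λ i → ¬ (lookup A i ≡ lookup B i × lookup B i ≡ lookup C i)
differing-coordinate {k} {A} {B} {C} ne =
  ¬∀⟶∃¬ k _ (λ i → (lookup A i Boolₚ.≟ lookup B i) ×-dec (lookup B i Boolₚ.≟ lookup C i))
        (λ same → ne (lookup-ext (proj₁ ∘ same) , lookup-ext (proj₂ ∘ same)))

Agree : Subset k → Vector (Fin N) k → Vector (Fin N) k → Set
Agree B y x = ∀ t → t ∈ B → y t ≡ x t

agree? : (B : Subset k) (y x : Vector (Fin N) k) → Dec (Agree B y x)
agree? B y x = all? (λ t → (t ∈? B) →-dec (y t ≟ x t))

agreeOn : Subset k → Vector (Fin N) k → Vector (Fin N) k → Bool
agreeOn B y x = ⌊ agree? B y x ⌋

Agree-insertAt : ∀ (S : Subset k) i s (w w′ : Vector (Fin N) k) a a′ →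
  Agree (Vec.insertAt S i s) (insertAt′ w i a) (insertAt′ w′ i a′) ⇔
  ((s ≡ inside → a ≡ a′) × Agree S w w′)
Agree-insertAt S i s w w′ a a′ = mk⇔
  (λ agree → let (agreeᵢ , agree′) = Equivalence.to (∀-punchIn i) agree
             in Equivalence.to at-i agreeᵢ , λ t → Equivalence.to (at-punchIn t) (agree′ t))
  (λ (agreeᵢ , agree′) → Equivalence.from (∀-punchIn i)
             (Equivalence.from at-i agreeᵢ , λ t → Equivalence.from (at-punchIn t) (agree′ t)))
  where
  at-i : (i ∈ Vec.insertAt S i s → insertAt′ w i a i ≡ insertAt′ w′ i a′ i) ⇔ (s ≡ inside → a ≡ a′)
  at-i = →-≡-⇔ (∈-insertAt-here S i) (insertAt′-lookup w i a) (insertAt′-lookup w′ i a′)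
  at-punchIn : ∀ t → (punchIn i t ∈ Vec.insertAt S i s →
                      insertAt′ w i a (punchIn i t) ≡ insertAt′ w′ i a′ (punchIn i t)) ⇔ (t ∈ S → w t ≡ w′ t)
  at-punchIn t = →-≡-⇔ (∈-insertAt-punchIn S i t) (insertAt′-punchIn w i a t) (insertAt′-punchIn w′ i a′ t)

agreeOn-insertAt-inside : ∀ (S : Subset k) i (w w′ : Vector (Fin N) k) a a′ →
  agreeOn (Vec.insertAt S i inside) (insertAt′ w i a) (insertAt′ w′ i a′) ≡ ⌊ a ≟ a′ ⌋ ∧ agreeOn S w w′
agreeOn-insertAt-inside S i w w′ a a′ = ≡.trans
  (⌊⌋-⇔ (mk⇔ (λ (h , ag) → h refl , ag) (λ (e , ag) → (λ _ → e) , ag) ⇔-∘ Agree-insertAt S i inside w w′ a a′)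
        (agree? _ _ _) ((a ≟ a′) ×-dec agree? S w w′))
  (⌊⌋-×-dec (a ≟ a′) (agree? S w w′))

agreeOn-insertAt-outside : ∀ (S : Subset k) i (w w′ : Vector (Fin N) k) a a′ →
  agreeOn (Vec.insertAt S i outside) (insertAt′ w i a) (insertAt′ w′ i a′) ≡ agreeOn S w w′
agreeOn-insertAt-outside S i w w′ a a′ =
  ⌊⌋-⇔ (mk⇔ proj₂ ((λ ()) ,_) ⇔-∘ Agree-insertAt S i outside w w′ a a′) (agree? _ _ _) (agree? S w w′)

module Sums {c ℓ} (R : CommutativeSemiring c ℓ) where
  open CommutativeSemiring R hiding (zero) renaming (refl to ≈-refl)
  open import Algebra.Properties.Semiring.Sum semiring public
    using ( sum; sum-cong-≋; sum-cong-≗; sum-replicate; sum-replicate-zero; sum-remove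
          ; ∑-comm; ∑-distrib-+; *-distribˡ-sum; *-distribʳ-sum)
  open import Algebra.Properties.CommutativeSemigroup +-commutativeSemigroup using (interchange)
  open import Relation.Binary.Reasoning.Setoid setoid

  indicator : Bool → Carrier
  indicator b = if b then 1# else 0#

  indicator-∧ : ∀ p q x → indicator (p ∧ q) * x ≈ indicator p * (indicator q * x)
  indicator-∧ true  q x = sym (*-identityˡ _)
  indicator-∧ false q x = trans (zeroˡ x) (sym (zeroˡ _))

  indicator-yes : ∀ {P : Set a} (P? : Dec P) → P → ∀ x → indicator ⌊ P? ⌋ * x ≈ x
  indicator-yes (yes _) _ x = *-identityˡ x
  indicator-yes (no ¬p) p x = ⊥-elim (¬p p)

  indicator-no : ∀ {P : Set a} (P? : Dec P) → ¬ P → ∀ x → indicator ⌊ P? ⌋ * x ≈ 0#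
  indicator-no (yes p) ¬p x = ⊥-elim (¬p p)
  indicator-no (no _)  _  x = zeroˡ x

  sum-zero : ∀ {m} {f : Fin m → Carrier} → (∀ a → f a ≈ 0#) → sum f ≈ 0#
  sum-zero {m} f≈0 = trans (sum-cong-≋ f≈0) (sum-replicate-zero m)

  sum-indicator-∃! : ∀ {m} {P : Fin m → Set a} (P? : ∀ a → Dec (P a)) (u : ∃! _≡_ P) (f : Fin m → Carrier) →
                     sum (λ a → indicator ⌊ P? a ⌋ * f a) ≈ f (proj₁ u)
  sum-indicator-∃! {m = suc m} P? (c , Pc , unique) f = begin
    sum t                              ≈⟨ sum-remove {i = c} t ⟩
    t c + sum (λ j → t (punchIn c j))  ≈⟨ +-cong (indicator-yes (P? c) Pc (f c)) (sum-zero off-c) ⟩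
    f c + 0#                           ≈⟨ +-identityʳ (f c) ⟩
    f c                                ∎
    where
    t = λ a → indicator ⌊ P? a ⌋ * f a
    off-c : ∀ j → t (punchIn c j) ≈ 0#
    off-c j = indicator-no (P? _) (punchInᵢ≢i c j ∘ ≡.sym ∘ unique) _

  data Slice {m} : Bool → (Fin m → Carrier) → Set (c ⊔ ℓ) where
    centred  : ∀ {F} → sum F ≈ 0# → Slice inside F
    constant : ∀ {F} f → (∀ a → F a ≈ f) → Slice outside F

  sumFin≡sum : ∀ {m} (f : Fin m → Carrier) → sumFin _+_ 0# f ≡ sum f
  sumFin≡sum {zero}  f = refl
  sumFin≡sum {suc m} f = ≡.cong (f zero +_) (sumFin≡sum (f ∘ suc))

  sumPoints : ∀ k → (Vector (Fin N) k → Carrier) → Carrier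
  sumPoints k = sumPts _+_ 0# k

  sumPoints-suc : ∀ k (f : Vector (Fin N) (suc k) → Carrier) →
                  sumPoints (suc k) f ≡ sum (λ a → sumPoints k (λ w → f (a Vector.∷ w)))
  sumPoints-suc k f = sumFin≡sum (λ a → sumPoints k (λ w → f (a Vector.∷ w)))

  sumPoints-cong : ∀ k {f g : Vector (Fin N) k → Carrier} → (∀ x → f x ≈ g x) → sumPoints k f ≈ sumPoints k g
  sumPoints-cong zero    f≈g = f≈g _
  sumPoints-cong (suc k) {f} {g} f≈g = begin
    sumPoints (suc k) f                              ≡⟨ sumPoints-suc k f ⟩
    sum (λ a → sumPoints k (λ w → f (a Vector.∷ w))) ≈⟨ sum-cong-≋ (λ a → sumPoints-cong k (f≈g ∘ (a Vector.∷_))) ⟩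
    sum (λ a → sumPoints k (λ w → g (a Vector.∷ w))) ≡⟨ sumPoints-suc k g ⟨
    sumPoints (suc k) g                              ∎

  sumPoints-zero : ∀ k {f : Vector (Fin N) k → Carrier} → (∀ x → f x ≈ 0#) → sumPoints k f ≈ 0#
  sumPoints-zero zero    f≈0 = f≈0 _
  sumPoints-zero (suc k) {f} f≈0 = begin
    sumPoints (suc k) f                              ≡⟨ sumPoints-suc k f ⟩
    sum (λ a → sumPoints k (λ w → f (a Vector.∷ w))) ≈⟨ sum-zero (λ a → sumPoints-zero k (f≈0 ∘ (a Vector.∷_))) ⟩
    0#                                               ∎

  sumPoints-*ʳ : ∀ k (f : Vector (Fin N) k → Carrier) x → sumPoints k (λ w → f w * x) ≈ sumPoints k f * x
  sumPoints-*ʳ zero    f x = ≈-refl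
  sumPoints-*ʳ (suc k) f x = begin
    sumPoints (suc k) (λ w → f w * x)
      ≡⟨ sumPoints-suc k (λ w → f w * x) ⟩
    sum (λ a → sumPoints k (λ w → f (a Vector.∷ w) * x))
      ≈⟨ sum-cong-≋ (λ a → sumPoints-*ʳ k (f ∘ (a Vector.∷_)) x) ⟩
    sum (λ a → sumPoints k (λ w → f (a Vector.∷ w)) * x)
      ≈⟨ *-distribʳ-sum x (λ a → sumPoints k (f ∘ (a Vector.∷_))) ⟨
    sum (λ a → sumPoints k (λ w → f (a Vector.∷ w))) * x
      ≡⟨ ≡.cong (_* x) (sumPoints-suc k f) ⟨
    sumPoints (suc k) f * x ∎

  sum-sumPoints-comm : ∀ {m} k (f : Fin m → Vector (Fin N) k → Carrier) →
                       sum (λ a → sumPoints k (f a)) ≈ sumPoints k (λ w → sum (λ a → f a w))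
  sum-sumPoints-comm zero    f = ≈-refl
  sum-sumPoints-comm (suc k) f = begin
    sum (λ a → sumPoints (suc k) (f a))
      ≡⟨ sum-cong-≗ (λ a → sumPoints-suc k (f a)) ⟩
    sum (λ a → sum (λ b → sumPoints k (λ w → f a (b Vector.∷ w))))
      ≈⟨ ∑-comm (λ a b → sumPoints k (λ w → f a (b Vector.∷ w))) ⟩
    sum (λ b → sum (λ a → sumPoints k (λ w → f a (b Vector.∷ w))))
      ≈⟨ sum-cong-≋ (λ b → sum-sumPoints-comm k (λ a w → f a (b Vector.∷ w))) ⟩
    sum (λ b → sumPoints k (λ w → sum (λ a → f a (b Vector.∷ w))))
      ≡⟨ sumPoints-suc k (λ w → sum (λ a → f a w)) ⟨
    sumPoints (suc k) (λ w → sum (λ a → f a w)) ∎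

  sumPoints-insertAt′ : ∀ k (i : Fin (suc k)) (f : Vector (Fin N) (suc k) → Carrier) →
                        sumPoints (suc k) f ≈ sumPoints k (λ w → sum (λ a → f (insertAt′ w i a)))
  sumPoints-insertAt′ k zero f = begin
    sumPoints (suc k) f                              ≡⟨ sumPoints-suc k f ⟩
    sum (λ a → sumPoints k (λ w → f (a Vector.∷ w))) ≈⟨ sum-sumPoints-comm k (λ a w → f (a Vector.∷ w)) ⟩
    sumPoints k (λ w → sum (λ a → f (a Vector.∷ w))) ∎
  sumPoints-insertAt′ (suc k) (suc i) f = begin
    sumPoints (suc (suc k)) f
      ≡⟨ sumPoints-suc (suc k) f ⟩
    sum (λ b → sumPoints (suc k) (λ v → f (b Vector.∷ v)))
      ≈⟨ sum-cong-≋ (λ b → sumPoints-insertAt′ k i (λ v → f (b Vector.∷ v))) ⟩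
    sum (λ b → sumPoints k (λ w → sum (λ a → f (b Vector.∷ insertAt′ w i a))))
      ≡⟨ sumPoints-suc k (λ w → sum (λ a → f (insertAt′ w (suc i) a))) ⟨
    sumPoints (suc k) (λ w → sum (λ a → f (insertAt′ w (suc i) a))) ∎

  sumPoints³-insertAt′ : ∀ k (i : Fin (suc k)) (f : (x y z : Vector (Fin N) (suc k)) → Carrier) →
    sumPoints (suc k) (λ x → sumPoints (suc k) (λ y → sumPoints (suc k) (λ z → f x y z))) ≈
    sumPoints k (λ x → sumPoints k (λ y → sumPoints k (λ z →
      sum (λ a → sum (λ b → sum (λ c → f (insertAt′ x i a) (insertAt′ y i b) (insertAt′ z i c)))))))
  sumPoints³-insertAt′ k i f = begin
    sumPoints (suc k) (λ x → sumPoints (suc k) (λ y → sumPoints (suc k) (λ z → f x y z)))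
      ≈⟨ sumPoints-cong (suc k) (λ x → sumPoints-cong (suc k) (λ y → sumPoints-insertAt′ k i (f x y))) ⟩
    sumPoints (suc k) (λ x → sumPoints (suc k) (λ y → sumPoints k (λ z → sum (λ c → f x y (ins z c)))))
      ≈⟨ sumPoints-cong (suc k) (λ x → sumPoints-insertAt′ k i (λ y → sumPoints k (λ z → sum (λ c → f x y (ins z c))))) ⟩
    sumPoints (suc k) (λ x → sumPoints k (λ y → sum (λ b → sumPoints k (λ z → sum (λ c → f x (ins y b) (ins z c))))))
      ≈⟨ sumPoints-insertAt′ k i (λ x → sumPoints k (λ y → sum (λ b → sumPoints k (λ z → sum (λ c →
           f x (ins y b) (ins z c)))))) ⟩
    sumPoints k (λ x → sum (λ a → sumPoints k (λ y → sum (λ b → sumPoints k (λ z → sum (λ c → g x a y z b c))))))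
      ≈⟨ sumPoints-cong k (λ x → sum-cong-≋ (λ a → sumPoints-cong k (λ y →
           sum-sumPoints-comm k (λ b z → sum (λ c → g x a y z b c))))) ⟩
    sumPoints k (λ x → sum (λ a → sumPoints k (λ y → sumPoints k (λ z → sum (λ b → sum (λ c → g x a y z b c))))))
      ≈⟨ sumPoints-cong k (λ x →
           trans (sum-sumPoints-comm k (λ a y → sumPoints k (λ z → sum (λ b → sum (λ c → g x a y z b c)))))
                 (sumPoints-cong k (λ y → sum-sumPoints-comm k (λ a z → sum (λ b → sum (λ c → g x a y z b c)))))) ⟩
    sumPoints k (λ x → sumPoints k (λ y → sumPoints k (λ z → sum (λ a → sum (λ b → sum (λ c → g x a y z b c)))))) ∎
    where
    ins = λ w a → insertAt′ w i a
    g = λ x a y z b c → f (insertAt′ x i a) (insertAt′ y i b) (insertAt′ z i c)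

  sumSubsets : ∀ k → (Subset k → Carrier) → Carrier
  sumSubsets k = sumSub _+_ 0# k

  sumSubsets-cong : ∀ k {f g : Subset k → Carrier} → (∀ B → f B ≈ g B) → sumSubsets k f ≈ sumSubsets k g
  sumSubsets-cong zero    f≈g = f≈g []
  sumSubsets-cong (suc k) f≈g =
    +-cong (sumSubsets-cong k (f≈g ∘ (inside ∷_))) (sumSubsets-cong k (f≈g ∘ (outside ∷_)))

  sumSubsets-zero : ∀ k {f : Subset k → Carrier} → (∀ B → f B ≈ 0#) → sumSubsets k f ≈ 0#
  sumSubsets-zero zero    f≈0 = f≈0 []
  sumSubsets-zero (suc k) f≈0 = trans
    (+-cong (sumSubsets-zero k (f≈0 ∘ (inside ∷_))) (sumSubsets-zero k (f≈0 ∘ (outside ∷_))))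
    (+-identityˡ 0#)

  sumSubsets-distrib-+ : ∀ k (f g : Subset k → Carrier) →
                         sumSubsets k (λ B → f B + g B) ≈ sumSubsets k f + sumSubsets k g
  sumSubsets-distrib-+ zero    f g = ≈-refl
  sumSubsets-distrib-+ (suc k) f g =
    trans (+-cong (sumSubsets-distrib-+ k _ _) (sumSubsets-distrib-+ k _ _)) (interchange _ _ _ _)

  sum-sumSubsets-comm : ∀ {m} k (f : Fin m → Subset k → Carrier) →
                        sum (λ a → sumSubsets k (f a)) ≈ sumSubsets k (λ B → sum (λ a → f a B))
  sum-sumSubsets-comm zero    f = ≈-refl
  sum-sumSubsets-comm (suc k) f = trans
    (∑-distrib-+ (λ a → sumSubsets k (f a ∘ (inside ∷_))) (λ a → sumSubsets k (f a ∘ (outside ∷_))))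
    (+-cong (sum-sumSubsets-comm k (λ a → f a ∘ (inside ∷_))) (sum-sumSubsets-comm k (λ a → f a ∘ (outside ∷_))))

  sumSubsets-insertAt : ∀ k (i : Fin (suc k)) (f : Subset (suc k) → Carrier) →
    sumSubsets (suc k) f ≈ sumSubsets k (λ S → f (Vec.insertAt S i inside) + f (Vec.insertAt S i outside))
  sumSubsets-insertAt k       zero    f = sym (sumSubsets-distrib-+ k _ _)
  sumSubsets-insertAt (suc k) (suc i) f =
    +-cong (sumSubsets-insertAt k i (f ∘ (inside ∷_))) (sumSubsets-insertAt k i (f ∘ (outside ∷_)))

  -- Q B f y unfolds to agreeSum B f y * inv (agreeCount B y).
  agreeSum : Subset k → (Vector (Fin N) k → Carrier) → Vector (Fin N) k → Carrier
  agreeSum {k} B f y = sumPoints k (λ x → indicator (agreeOn B y x) * f x)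

  agreeSum-insertAt-inside : ∀ k (S : Subset k) i (f : Vector (Fin N) (suc k) → Carrier) w a →
    agreeSum (Vec.insertAt S i inside) f (insertAt′ w i a) ≈ agreeSum S (λ w′ → f (insertAt′ w′ i a)) w
  agreeSum-insertAt-inside k S i f w a = trans (sumPoints-insertAt′ k i summand) (sumPoints-cong k λ w′ → begin
    sum (λ a′ → summand (insertAt′ w′ i a′))
      ≡⟨ sum-cong-≗ (λ a′ → ≡.cong (λ b → indicator b * f (insertAt′ w′ i a′))
                                   (agreeOn-insertAt-inside S i w w′ a a′)) ⟩
    sum (λ a′ → indicator (⌊ a ≟ a′ ⌋ ∧ agreeOn S w w′) * f (insertAt′ w′ i a′))
      ≈⟨ sum-cong-≋ (λ a′ → indicator-∧ ⌊ a ≟ a′ ⌋ (agreeOn S w w′) _) ⟩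
    sum (λ a′ → indicator ⌊ a ≟ a′ ⌋ * (indicator (agreeOn S w w′) * f (insertAt′ w′ i a′)))
      ≈⟨ sum-indicator-∃! (a ≟_) (a , refl , id) (λ a′ → indicator (agreeOn S w w′) * f (insertAt′ w′ i a′)) ⟩
    indicator (agreeOn S w w′) * f (insertAt′ w′ i a) ∎)
    where summand = λ x → indicator (agreeOn (Vec.insertAt S i inside) (insertAt′ w i a) x) * f x

  agreeSum-insertAt-outside : ∀ k (S : Subset k) i (f : Vector (Fin N) (suc k) → Carrier) w a →
    agreeSum (Vec.insertAt S i outside) f (insertAt′ w i a) ≈
    agreeSum S (λ w′ → sum (λ a′ → f (insertAt′ w′ i a′))) w
  agreeSum-insertAt-outside k S i f w a = trans (sumPoints-insertAt′ k i summand) (sumPoints-cong k λ w′ → begin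
    sum (λ a′ → summand (insertAt′ w′ i a′))
      ≡⟨ sum-cong-≗ (λ a′ → ≡.cong (λ b → indicator b * f (insertAt′ w′ i a′))
                                   (agreeOn-insertAt-outside S i w w′ a a′)) ⟩
    sum (λ a′ → indicator (agreeOn S w w′) * f (insertAt′ w′ i a′))
      ≈⟨ *-distribˡ-sum (indicator (agreeOn S w w′)) (λ a′ → f (insertAt′ w′ i a′)) ⟨
    indicator (agreeOn S w w′) * sum (λ a′ → f (insertAt′ w′ i a′)) ∎)
    where summand = λ x → indicator (agreeOn (Vec.insertAt S i outside) (insertAt′ w i a) x) * f x

  sum-agreeSum : ∀ {m} k (B : Subset k) (f : Fin m → Vector (Fin N) k → Carrier) y →
                 sum (λ a → agreeSum B (f a) y) ≈ agreeSum B (λ x → sum (λ a → f a x)) y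
  sum-agreeSum k B f y = trans (sum-sumPoints-comm k (λ a x → indicator (agreeOn B y x) * f a x))
    (sumPoints-cong k λ x → sym (*-distribˡ-sum (indicator (agreeOn B y x)) (λ a → f a x)))

module ℕ-Sums = Sums ℕₚ.+-*-commutativeSemiring

agreeCount : Subset k → Vector (Fin N) k → ℕ
agreeCount {k} B y = sumPts ℕ._+_ 0 k (λ x → if agreeOn B y x then 1 else 0)

agreeCount≡agreeSum : ∀ k (B : Subset k) (y : Vector (Fin N) k) → agreeCount B y ≡ ℕ-Sums.agreeSum B (λ _ → 1) y
agreeCount≡agreeSum k B y = ≡.sym (ℕ-Sums.sumPoints-cong k (λ x → ℕₚ.*-identityʳ _))

sum-ones : ∀ N → ℕ-Sums.sum {N} (λ _ → 1) ≡ N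
sum-ones zero    = refl
sum-ones (suc N) = ≡.cong suc (sum-ones N)

agreeCount-insertAt-inside : ∀ k (S : Subset k) i (w : Vector (Fin N) k) a →
  agreeCount (Vec.insertAt S i inside) (insertAt′ w i a) ≡ agreeCount S w
agreeCount-insertAt-inside k S i w a = begin
  agreeCount (Vec.insertAt S i inside) (insertAt′ w i a)
    ≡⟨ agreeCount≡agreeSum (suc k) (Vec.insertAt S i inside) (insertAt′ w i a) ⟩
  agreeSum (Vec.insertAt S i inside) (λ _ → 1) (insertAt′ w i a)
    ≡⟨ ℕ-Sums.agreeSum-insertAt-inside k S i (λ _ → 1) w a ⟩
  agreeSum S (λ _ → 1) w
    ≡⟨ agreeCount≡agreeSum k S w ⟨
  agreeCount S w ∎
  where open ≡.≡-Reasoning; open ℕ-Sums using (agreeSum)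

agreeCount-insertAt-outside : ∀ k (S : Subset k) i (w : Vector (Fin N) k) a →
  agreeCount (Vec.insertAt S i outside) (insertAt′ w i a) ≡ agreeCount S w ℕ.* N
agreeCount-insertAt-outside {N = N} k S i w a = begin
  agreeCount (Vec.insertAt S i outside) (insertAt′ w i a)
    ≡⟨ agreeCount≡agreeSum (suc k) (Vec.insertAt S i outside) (insertAt′ w i a) ⟩
  agreeSum (Vec.insertAt S i outside) (λ _ → 1) (insertAt′ w i a)
    ≡⟨ ℕ-Sums.agreeSum-insertAt-outside k S i (λ _ → 1) w a ⟩
  agreeSum S (λ _ → sum {N} (λ _ → 1)) w
    ≡⟨ ≡.cong (λ m → agreeSum S (λ _ → m) w) (sum-ones N) ⟩
  agreeSum S (λ _ → N) w
    ≡⟨ ℕ-Sums.sumPoints-*ʳ k _ N ⟩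
  agreeCount S w ℕ.* N ∎
  where open ≡.≡-Reasoning; open ℕ-Sums using (agreeSum; sum)

agreeCount-cong : ∀ k (B : Subset k) {y y′ : Vector (Fin N) k} → y ≗ y′ → agreeCount B y ≡ agreeCount B y′
agreeCount-cong k B y≗y′ = ℕ-Sums.sumPoints-cong k λ x → ≡.cong (λ b → if b then 1 else 0)
  (⌊⌋-⇔ (mk⇔ (λ ag t → ≡.trans (≡.sym (y≗y′ t)) ∘ ag t) (λ ag t → ≡.trans (y≗y′ t) ∘ ag t))
        (agree? _ _ _) (agree? _ _ _))

agreeCount-nonzero : ∀ {m} (S : Subset k) (y : Vector (Fin (suc m)) k) → agreeCount S y ≢ 0
agreeCount-nonzero []              y ()
agreeCount-nonzero {suc k} (s ∷ S) y count≡0 =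
  agreeCount-nonzero S (tail y) (peel s (≡.trans (≡.sym (agreeCount-cong (suc k) (s ∷ S) y≗)) count≡0))
  where
  y≗ : y ≗ head y Vector.∷ tail y
  y≗ zero    = refl
  y≗ (suc t) = refl
  peel : ∀ s → agreeCount (s ∷ S) (head y Vector.∷ tail y) ≡ 0 → agreeCount S (tail y) ≡ 0
  peel inside  eq = ≡.trans (≡.sym (agreeCount-insertAt-inside k S zero (tail y) (head y))) eq
  peel outside eq = [ id , (λ ()) ]′ (ℕₚ.m*n≡0⇒m≡0∨n≡0 _
    (≡.trans (≡.sym (agreeCount-insertAt-outside k S zero (tail y) (head y))) eq))

module Latin {c ℓ} (R : CommutativeSemiring c ℓ) (Ls : LatinSquare N) where
  open CommutativeSemiring R hiding (zero) renaming (refl to ≈-refl)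
  open Sums R
  open LatinSquare Ls
  open import Relation.Binary.Reasoning.Setoid setoid

  latinSum : (F G H : Fin N → Carrier) → Carrier
  latinSum F G H = sum (λ a → sum (λ b → sum (λ c → indicator ⌊ L? a b c ⌋ * (F a * (G b * H c)))))

  sum-*-sum : ∀ {m p} (f : Fin m → Carrier) (g : Fin p → Carrier) →
              sum (λ a → sum (λ b → f a * g b)) ≈ sum f * sum g
  sum-*-sum f g = trans (sum-cong-≋ (λ a → sym (*-distribˡ-sum (f a) g))) (sym (*-distribʳ-sum (sum g) f))

  latinSum-cong : ∀ {F F′ G G′ H H′} → (∀ a → F a ≈ F′ a) → (∀ b → G b ≈ G′ b) → (∀ c → H c ≈ H′ c) →
                  latinSum F G H ≈ latinSum F′ G′ H′
  latinSum-cong F≈F′ G≈G′ H≈H′ =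
    sum-cong-≋ λ a → sum-cong-≋ λ b → sum-cong-≋ λ c → *-congˡ (*-cong (F≈F′ a) (*-cong (G≈G′ b) (H≈H′ c)))

  latinSum-constʳ : ∀ F G {H} h → (∀ c → H c ≈ h) → latinSum F G H ≈ sum F * (sum G * h)
  latinSum-constʳ F G {H} h H≈h = begin
    latinSum F G H
      ≈⟨ latinSum-cong (λ _ → ≈-refl) (λ _ → ≈-refl) H≈h ⟩
    latinSum F G (λ _ → h)
      ≈⟨ sum-cong-≋ (λ a → sum-cong-≋ (λ b → sum-indicator-∃! (L? a b) (uniqXY a b) (λ _ → F a * (G b * h)))) ⟩
    sum (λ a → sum (λ b → F a * (G b * h)))
      ≈⟨ sum-*-sum F (λ b → G b * h) ⟩
    sum F * sum (λ b → G b * h)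
      ≈⟨ *-congˡ (*-distribʳ-sum h G) ⟨
    sum F * (sum G * h) ∎

  latinSum-constᵐ : ∀ F {G} g H → (∀ b → G b ≈ g) → latinSum F G H ≈ sum F * (g * sum H)
  latinSum-constᵐ F {G} g H G≈g = begin
    latinSum F G H
      ≈⟨ latinSum-cong (λ _ → ≈-refl) G≈g (λ _ → ≈-refl) ⟩
    latinSum F (λ _ → g) H
      ≈⟨ sum-cong-≋ (λ a → ∑-comm (λ b c → indicator ⌊ L? a b c ⌋ * (F a * (g * H c)))) ⟩
    sum (λ a → sum (λ c → sum (λ b → indicator ⌊ L? a b c ⌋ * (F a * (g * H c)))))
      ≈⟨ sum-cong-≋ (λ a → sum-cong-≋ (λ c →
           sum-indicator-∃! (λ b → L? a b c) (uniqZX c a) (λ _ → F a * (g * H c)))) ⟩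
    sum (λ a → sum (λ c → F a * (g * H c)))
      ≈⟨ sum-*-sum F (λ c → g * H c) ⟩
    sum F * sum (λ c → g * H c)
      ≈⟨ *-congˡ (*-distribˡ-sum g H) ⟨
    sum F * (g * sum H) ∎

  latinSum-constˡ : ∀ {F} f G H → (∀ a → F a ≈ f) → latinSum F G H ≈ f * (sum G * sum H)
  latinSum-constˡ {F} f G H F≈f = begin
    latinSum F G H
      ≈⟨ latinSum-cong F≈f (λ _ → ≈-refl) (λ _ → ≈-refl) ⟩
    latinSum (λ _ → f) G H
      ≈⟨ ∑-comm (λ a b → sum (λ c → indicator ⌊ L? a b c ⌋ * (f * (G b * H c)))) ⟩
    sum (λ b → sum (λ a → sum (λ c → indicator ⌊ L? a b c ⌋ * (f * (G b * H c)))))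
      ≈⟨ sum-cong-≋ (λ b → ∑-comm (λ a c → indicator ⌊ L? a b c ⌋ * (f * (G b * H c)))) ⟩
    sum (λ b → sum (λ c → sum (λ a → indicator ⌊ L? a b c ⌋ * (f * (G b * H c)))))
      ≈⟨ sum-cong-≋ (λ b → sum-cong-≋ (λ c →
           sum-indicator-∃! (λ a → L? a b c) (uniqYZ b c) (λ _ → f * (G b * H c)))) ⟩
    sum (λ b → sum (λ c → f * (G b * H c)))
      ≈⟨ sum-cong-≋ (λ b → *-distribˡ-sum f (λ c → G b * H c)) ⟨
    sum (λ b → f * sum (λ c → G b * H c))
      ≈⟨ *-distribˡ-sum f (λ b → sum (λ c → G b * H c)) ⟨
    f * sum (λ b → sum (λ c → G b * H c))
      ≈⟨ *-congˡ (sum-*-sum G H) ⟩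
    f * (sum G * sum H) ∎

  latinSum-slices : ∀ {α β γ F G H} → ¬ (α ≡ β × β ≡ γ) →
                    Slice α F → Slice β G → Slice γ H → latinSum F G H ≈ 0#
  latinSum-slices ne (centred _)    (centred _)    (centred _)    = ⊥-elim (ne (refl , refl))
  latinSum-slices ne (constant _ _) (constant _ _) (constant _ _) = ⊥-elim (ne (refl , refl))
  latinSum-slices {F = F} {H = H} _ (centred ΣF≈0) (constant g G≈g) _ =
    trans (latinSum-constᵐ F g H G≈g) (trans (*-congʳ ΣF≈0) (zeroˡ _))
  latinSum-slices {F = F} {G} _ (centred ΣF≈0) (centred _) (constant h H≈h) =
    trans (latinSum-constʳ F G h H≈h) (trans (*-congʳ ΣF≈0) (zeroˡ _))
  latinSum-slices {G = G} {H} _ (constant f F≈f) (centred ΣG≈0) _ =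
    trans (latinSum-constˡ f G H F≈f) (trans (*-congˡ (trans (*-congʳ ΣG≈0) (zeroˡ _))) (zeroʳ f))
  latinSum-slices {G = G} {H} _ (constant f F≈f) (constant _ _) (centred ΣH≈0) =
    trans (latinSum-constˡ f G H F≈f) (trans (*-congˡ (trans (*-congˡ ΣH≈0) (zeroʳ _))) (zeroʳ f))

  inLᵏ : (x y z : Vector (Fin N) k) → Bool
  inLᵏ x y z = ⌊ all? (λ t → L? (x t) (y t) (z t)) ⌋

  inLᵏ-insertAt′ : ∀ (x y z : Vector (Fin N) k) i a b c →
    inLᵏ (insertAt′ x i a) (insertAt′ y i b) (insertAt′ z i c) ≡ inLᵏ x y z ∧ ⌊ L? a b c ⌋
  inLᵏ-insertAt′ x y z i a b c = ≡.trans
    (⌊⌋-⇔ (mk⇔ (λ inL → let (inLᵢ , inL′) = Equivalence.to (∀-punchIn i) inL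
                         in (λ t → Equivalence.to (at-punchIn t) (inL′ t)) , Equivalence.to at-i inLᵢ)
               (λ (inL , Labc) → Equivalence.from (∀-punchIn i)
                         (Equivalence.from at-i Labc , λ t → Equivalence.from (at-punchIn t) (inL t))))
          (all? (λ t → L? (insertAt′ x i a t) (insertAt′ y i b t) (insertAt′ z i c t)))
          (all? (λ t → L? (x t) (y t) (z t)) ×-dec L? a b c))
    (⌊⌋-×-dec (all? (λ t → L? (x t) (y t) (z t))) (L? a b c))
    where
    L-resp⇔ : ∀ {u u′ v v′ w w′} → u ≡ u′ → v ≡ v′ → w ≡ w′ → L u v w ⇔ L u′ v′ w′
    L-resp⇔ refl refl refl = mk⇔ id id
    at-punchIn : ∀ t → L (insertAt′ x i a (punchIn i t)) (insertAt′ y i b (punchIn i t)) (insertAt′ z i c (punchIn i t))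
                       ⇔ L (x t) (y t) (z t)
    at-punchIn t = L-resp⇔ (insertAt′-punchIn x i a t) (insertAt′-punchIn y i b t) (insertAt′-punchIn z i c t)
    at-i : L (insertAt′ x i a i) (insertAt′ y i b i) (insertAt′ z i c i) ⇔ L a b c
    at-i = L-resp⇔ (insertAt′-lookup x i a) (insertAt′-lookup y i b) (insertAt′-lookup z i c)

  latinSumᵏ : ∀ k → (F G H : Vector (Fin N) k → Carrier) → Carrier
  latinSumᵏ k F G H =
    sumPoints k (λ x → sumPoints k (λ y → sumPoints k (λ z → indicator (inLᵏ x y z) * (F x * (G y * H z)))))

  latinSumᵏ-insertAt′ : ∀ k (i : Fin (suc k)) F G H → latinSumᵏ (suc k) F G H ≈
    sumPoints k (λ x → sumPoints k (λ y → sumPoints k (λ z →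
      indicator (inLᵏ x y z) *
      latinSum (λ a → F (insertAt′ x i a)) (λ b → G (insertAt′ y i b)) (λ c → H (insertAt′ z i c)))))
  latinSumᵏ-insertAt′ k i F G H =
    trans (sumPoints³-insertAt′ k i (λ x y z → indicator (inLᵏ x y z) * (F x * (G y * H z))))
          (sumPoints-cong k λ x → sumPoints-cong k λ y → sumPoints-cong k λ z → factor x y z)
    where
    factor : ∀ x y z →
      sum (λ a → sum (λ b → sum (λ c → indicator (inLᵏ (insertAt′ x i a) (insertAt′ y i b) (insertAt′ z i c)) *
                                        (F (insertAt′ x i a) * (G (insertAt′ y i b) * H (insertAt′ z i c))))))
      ≈ indicator (inLᵏ x y z) *
        latinSum (λ a → F (insertAt′ x i a)) (λ b → G (insertAt′ y i b)) (λ c → H (insertAt′ z i c))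
    factor x y z = begin
      sum (λ a → sum (λ b → sum (λ c → indicator (inLᵏ (insertAt′ x i a) (insertAt′ y i b) (insertAt′ z i c)) * Φ a b c)))
        ≈⟨ sum-cong-≋ (λ a → sum-cong-≋ λ b → sum-cong-≋ λ c → trans
             (reflexive (≡.cong (λ t → indicator t * Φ a b c) (inLᵏ-insertAt′ x y z i a b c)))
             (indicator-∧ (inLᵏ x y z) ⌊ L? a b c ⌋ (Φ a b c))) ⟩
      sum (λ a → sum (λ b → sum (λ c → ι * (indicator ⌊ L? a b c ⌋ * Φ a b c))))
        ≈⟨ sum-cong-≋ (λ a → sum-cong-≋ λ b → *-distribˡ-sum ι (λ c → indicator ⌊ L? a b c ⌋ * Φ a b c)) ⟨
      sum (λ a → sum (λ b → ι * sum (λ c → indicator ⌊ L? a b c ⌋ * Φ a b c)))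
        ≈⟨ sum-cong-≋ (λ a → *-distribˡ-sum ι (λ b → sum (λ c → indicator ⌊ L? a b c ⌋ * Φ a b c))) ⟨
      sum (λ a → ι * sum (λ b → sum (λ c → indicator ⌊ L? a b c ⌋ * Φ a b c)))
        ≈⟨ *-distribˡ-sum ι (λ a → sum (λ b → sum (λ c → indicator ⌊ L? a b c ⌋ * Φ a b c))) ⟨
      ι * latinSum (λ a → F (insertAt′ x i a)) (λ b → G (insertAt′ y i b)) (λ c → H (insertAt′ z i c)) ∎
      where
      ι = indicator (inLᵏ x y z)
      Φ = λ a b c → F (insertAt′ x i a) * (G (insertAt′ y i b) * H (insertAt′ z i c))

  latinSumᵏ-slices : ∀ k (i : Fin (suc k)) {α β γ} {F G H : Vector (Fin N) (suc k) → Carrier} →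
    ¬ (α ≡ β × β ≡ γ) →
    (∀ x → Slice α (λ a → F (insertAt′ x i a))) → (∀ y → Slice β (λ b → G (insertAt′ y i b))) →
    (∀ z → Slice γ (λ c → H (insertAt′ z i c))) → latinSumᵏ (suc k) F G H ≈ 0#
  latinSumᵏ-slices k i {F = F} {G} {H} ne F-slice G-slice H-slice = trans (latinSumᵏ-insertAt′ k i F G H)
    (sumPoints-zero k λ x → sumPoints-zero k λ y → sumPoints-zero k λ z →
      trans (*-congˡ (latinSum-slices ne (F-slice x) (G-slice y) (H-slice z))) (zeroʳ _))

module Projections {c ℓ} (S : Scalars c ℓ) where
  open Scalars S
  open CommutativeRing scalarRing hiding (zero) renaming (refl to ≈-refl)
  open Sums commutativeSemiring
  open import Algebra.Properties.Semiring.Mult semiring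
    using (×-congʳ; ×1-homo-*; ×-assoc-*; ×-comm-*) renaming (_×_ to _×′_)
  open import Algebra.Properties.Ring ring using (-‿distribˡ-*; -‿distribʳ-*)
  open import Algebra.Solver.CommutativeMonoid *-commutativeMonoid using (solve; _⊕_; _⊜_)
  open import Relation.Binary.Reasoning.Setoid setoid

  natR≈×1# : ∀ m → natR scalarRing m ≈ m ×′ 1#
  natR≈×1# zero    = ≈-refl
  natR≈×1# (suc m) = +-congˡ (natR≈×1# m)

  ×-inv : ∀ m p → m ≢ 0 → p ≢ 0 → p ×′ inv (m ℕ.* p) ≈ inv m
  ×-inv m p m≢0 p≢0 = begin
    p ×′ inv (m ℕ.* p)         ≈⟨ ×-congʳ p (*-identityˡ _) ⟨
    p ×′ (1# * inv (m ℕ.* p))  ≈⟨ ×-assoc-* p 1# _ ⟨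
    p̂ * v                      ≈⟨ *-identityˡ _ ⟨
    1# * (p̂ * v)               ≈⟨ *-congʳ m̂u≈1 ⟨
    (m̂ * u) * (p̂ * v)          ≈⟨ solve 4 (λ m̂ p̂ u v → (m̂ ⊕ u) ⊕ (p̂ ⊕ v) ⊜ u ⊕ ((m̂ ⊕ p̂) ⊕ v))
                                           ≈-refl m̂ p̂ u v ⟩
    u * ((m̂ * p̂) * v)          ≈⟨ *-congˡ (*-congʳ (×1-homo-* m p)) ⟨
    u * ((m ℕ.* p) ×′ 1# * v)  ≈⟨ *-congˡ mp̂v≈1 ⟩
    u * 1#                     ≈⟨ *-identityʳ u ⟩
    u                          ∎
    where
    u = inv m
    v = inv (m ℕ.* p)
    m̂ = m ×′ 1#
    p̂ = p ×′ 1#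
    m̂u≈1 : m̂ * u ≈ 1#
    m̂u≈1 = trans (*-congʳ (sym (natR≈×1# m))) (inv-law m m≢0)
    mp̂v≈1 : (m ℕ.* p) ×′ 1# * v ≈ 1#
    mp̂v≈1 = trans (*-congʳ (sym (natR≈×1# (m ℕ.* p))))
                  (inv-law (m ℕ.* p) ([ m≢0 , p≢0 ]′ ∘ ℕₚ.m*n≡0⇒m≡0∨n≡0 m))

  Q-insertAt-outside : ∀ {k} (T : Subset k) i (f : Fun S (suc k)) w a →
    Q S (Vec.insertAt T i outside) f (insertAt′ w i a) ≈
    agreeSum T (λ w′ → sum (λ a′ → f (insertAt′ w′ i a′))) w * inv (agreeCount T w ℕ.* suc k)
  Q-insertAt-outside {k} T i f w a = *-cong (agreeSum-insertAt-outside k T i f w a)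
                                            (reflexive (≡.cong inv (agreeCount-insertAt-outside k T i w a)))

  sum-Q-insertAt-inside : ∀ {k} (T : Subset k) i (f : Fun S (suc k)) w →
    sum (λ a → Q S (Vec.insertAt T i inside) f (insertAt′ w i a)) ≈
    agreeSum T (λ w′ → sum (λ a′ → f (insertAt′ w′ i a′))) w * inv (agreeCount T w)
  sum-Q-insertAt-inside {k} T i f w = begin
    sum (λ a → Q S (Vec.insertAt T i inside) f (insertAt′ w i a))
      ≈⟨ sum-cong-≋ (λ a → *-cong (agreeSum-insertAt-inside k T i f w a)
                                  (reflexive (≡.cong inv (agreeCount-insertAt-inside k T i w a)))) ⟩
    sum (λ a → agreeSum T (λ w′ → f (insertAt′ w′ i a)) w * inv (agreeCount T w))
      ≈⟨ *-distribʳ-sum (inv (agreeCount T w)) (λ a → agreeSum T (λ w′ → f (insertAt′ w′ i a)) w) ⟨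
    sum (λ a → agreeSum T (λ w′ → f (insertAt′ w′ i a)) w) * inv (agreeCount T w)
      ≈⟨ *-congʳ (sum-agreeSum k T (λ a w′ → f (insertAt′ w′ i a)) w) ⟩
    agreeSum T (λ w′ → sum (λ a′ → f (insertAt′ w′ i a′))) w * inv (agreeCount T w) ∎

  sum-Q-insertAt : ∀ {k} (T : Subset k) i (f : Fun S (suc k)) w →
    sum (λ a → Q S (Vec.insertAt T i inside) f (insertAt′ w i a)) ≈
    sum (λ a → Q S (Vec.insertAt T i outside) f (insertAt′ w i a))
  sum-Q-insertAt {k} T i f w = begin
    sum (λ a → Q S (Vec.insertAt T i inside) f (insertAt′ w i a))
      ≈⟨ sum-Q-insertAt-inside T i f w ⟩
    M * inv count
      ≈⟨ *-congˡ (×-inv count (suc k) (agreeCount-nonzero T w) λ ()) ⟨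
    M * (suc k ×′ inv (count ℕ.* suc k))
      ≈⟨ ×-comm-* (suc k) M (inv (count ℕ.* suc k)) ⟩
    suc k ×′ (M * inv (count ℕ.* suc k))
      ≈⟨ sum-replicate (suc k) ⟨
    sum {suc k} (λ _ → M * inv (count ℕ.* suc k))
      ≈⟨ sum-cong-≋ {suc k} (Q-insertAt-outside T i f w) ⟨
    sum (λ a → Q S (Vec.insertAt T i outside) f (insertAt′ w i a)) ∎
    where
    M = agreeSum T (λ w′ → sum (λ a′ → f (insertAt′ w′ i a′))) w
    count = agreeCount T w

  projectionTerm : ∀ {n} → Subset n → Fun S n → (Fin n → Fin n) → Subset n → Carrier
  projectionTerm A f y B = ind S ⌊ B ⊆? A ⌋ * (sign S ∣ A ─ B ∣ * Q S B f y)

  sum-projectionTerm-pair : ∀ {k} (A T : Subset k) i (f : Fun S (suc k)) w →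
    let A′ = Vec.insertAt A i inside
        term = λ B → sum (λ a → projectionTerm A′ f (insertAt′ w i a) B)
    in term (Vec.insertAt T i inside) + term (Vec.insertAt T i outside) ≈ 0#
  sum-projectionTerm-pair A T i f w = begin
    term Tᵢ + term Tₒ
      ≈⟨ +-cong (pull Tᵢ) (pull Tₒ) ⟩
    ind S ⌊ Tᵢ ⊆? A′ ⌋ * (sign S ∣ A′ ─ Tᵢ ∣ * Xᵢ) + ind S ⌊ Tₒ ⊆? A′ ⌋ * (sign S ∣ A′ ─ Tₒ ∣ * Xₒ)
      ≡⟨ ≡.cong₂ _+_ (≡.cong₂ (λ b m → ind S b * (sign S m * Xᵢ)) (⊆-eq inside) (∣insertAt─insertAt∣ A T i inside))
                     (≡.cong₂ (λ b m → ind S b * (sign S m * Xₒ)) (⊆-eq outside) (∣insertAt─insertAt∣ A T i outside)) ⟩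
    ι * (σ * Xᵢ) + ι * (- σ * Xₒ)
      ≈⟨ +-congˡ (*-congˡ (*-congˡ (sum-Q-insertAt T i f w))) ⟨
    ι * (σ * Xᵢ) + ι * (- σ * Xᵢ)
      ≈⟨ +-congˡ (trans (-‿distribʳ-* ι (σ * Xᵢ)) (*-congˡ (-‿distribˡ-* σ Xᵢ))) ⟨
    ι * (σ * Xᵢ) + - (ι * (σ * Xᵢ))
      ≈⟨ -‿inverseʳ _ ⟩
    0# ∎
    where
    A′ = Vec.insertAt A i inside
    Tᵢ = Vec.insertAt T i inside
    Tₒ = Vec.insertAt T i outside
    term = λ B → sum (λ a → projectionTerm A′ f (insertAt′ w i a) B)
    Xᵢ = sum (λ a → Q S Tᵢ f (insertAt′ w i a))
    Xₒ = sum (λ a → Q S Tₒ f (insertAt′ w i a))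
    ι = ind S ⌊ T ⊆? A ⌋
    σ = sign S ∣ A ─ T ∣
    pull : ∀ B → term B ≈ ind S ⌊ B ⊆? A′ ⌋ * (sign S ∣ A′ ─ B ∣ * sum (λ a → Q S B f (insertAt′ w i a)))
    pull B = sym (trans (*-congˡ (*-distribˡ-sum (sign S ∣ A′ ─ B ∣) (λ a → Q S B f (insertAt′ w i a))))
                        (*-distribˡ-sum (ind S ⌊ B ⊆? A′ ⌋) (λ a → sign S ∣ A′ ─ B ∣ * Q S B f (insertAt′ w i a))))
    ⊆-eq : ∀ s → ⌊ Vec.insertAt T i s ⊆? A′ ⌋ ≡ ⌊ T ⊆? A ⌋
    ⊆-eq s = ⌊⌋-⇔ (insertAt-⊆-insertAt T A i s) (Vec.insertAt T i s ⊆? A′) (T ⊆? A)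

  P-insertAt-inside : ∀ {k} (A : Subset k) i (f : Fun S (suc k)) w →
    sum (λ a → P S (Vec.insertAt A i inside) f (insertAt′ w i a)) ≈ 0#
  P-insertAt-inside {k} A i f w = begin
    sum (λ a → sumSubsets (suc k) (λ B → term B a))
      ≈⟨ sum-sumSubsets-comm (suc k) (λ a B → term B a) ⟩
    sumSubsets (suc k) (λ B → sum (term B))
      ≈⟨ sumSubsets-insertAt k i (λ B → sum (term B)) ⟩
    sumSubsets k (λ T → sum (term (Vec.insertAt T i inside)) + sum (term (Vec.insertAt T i outside)))
      ≈⟨ sumSubsets-zero k (λ T → sum-projectionTerm-pair A T i f w) ⟩
    0# ∎
    where term = λ B a → projectionTerm (Vec.insertAt A i inside) f (insertAt′ w i a) B

  P-insertAt-outside : ∀ {k} (A : Subset k) i (f : Fun S (suc k)) w a b →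
    P S (Vec.insertAt A i outside) f (insertAt′ w i a) ≈ P S (Vec.insertAt A i outside) f (insertAt′ w i b)
  P-insertAt-outside {k} A i f w a b = begin
    P S A′ f (insertAt′ w i a)
      ≈⟨ sumSubsets-insertAt k i (term a) ⟩
    sumSubsets k (λ T → term a (Vec.insertAt T i inside) + term a (Vec.insertAt T i outside))
      ≈⟨ sumSubsets-cong k (λ T → +-cong (trans (vanish a T) (sym (vanish b T)))
           (*-congˡ (*-congˡ (trans (Q-insertAt-outside T i f w a) (sym (Q-insertAt-outside T i f w b)))))) ⟩
    sumSubsets k (λ T → term b (Vec.insertAt T i inside) + term b (Vec.insertAt T i outside))
      ≈⟨ sumSubsets-insertAt k i (term b) ⟨
    P S A′ f (insertAt′ w i b) ∎
    where
    A′ = Vec.insertAt A i outside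
    term = λ a → projectionTerm A′ f (insertAt′ w i a)
    vanish : ∀ a T → term a (Vec.insertAt T i inside) ≈ 0#
    vanish a T = indicator-no (Vec.insertAt T i inside ⊆? A′) (insertAt-⊈-insertAt T A i) _

  P-slice : ∀ {k} (A : Subset (suc k)) i (f : Fun S (suc k)) w →
            Slice (lookup A i) (λ a → P S A f (insertAt′ w i a))
  P-slice A i f w = subst (λ A′ → Slice (lookup A i) (λ a → P S A′ f (insertAt′ w i a)))
                          (Vecₚ.insertAt-removeAt A i) (slice (Vec.removeAt A i) (lookup A i))
    where
    slice : ∀ A′ α → Slice α (λ a → P S (Vec.insertAt A′ i α) f (insertAt′ w i a))
    slice A′ inside  = centred (P-insertAt-inside A′ i f w)
    slice A′ outside = constant _ (λ a → P-insertAt-outside A′ i f w a zero)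

lemma2p1 : ∀ {c ℓ : Level} (S : Scalars c ℓ) (n : ℕ) (Ls : LatinSquare n)
    (f g h : Fun S n) (A B C : Subset n) →
    ¬ (A ≡ B × B ≡ C) →
    _≈S_ S (Λ S Ls (P S A f) (P S B g) (P S C h)) (0S S)
lemma2p1 S zero    Ls f g h [] [] [] ne = ⊥-elim (ne (refl , refl))
lemma2p1 S (suc k) Ls f g h A  B  C  ne = begin
  Λ S Ls (P S A f) (P S B g) (P S C h)                 ≡⟨⟩
  latinSumᵏ (suc k) (P S A f) (P S B g) (P S C h) * _  ≈⟨ *-congʳ vanishes ⟩
  0# * _                                               ≈⟨ zeroˡ _ ⟩
  0#                                                   ∎
  where
  open Scalars S
  open CommutativeRing scalarRing hiding (zero)
  open Latin commutativeSemiring Ls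
  open Projections S
  open import Relation.Binary.Reasoning.Setoid setoid
  i = proj₁ (differing-coordinate ne)
  vanishes : latinSumᵏ (suc k) (P S A f) (P S B g) (P S C h) ≈ 0#
  vanishes = latinSumᵏ-slices k i {F = P S A f} {P S B g} {P S C h} (proj₂ (differing-coordinate ne))
                              (P-slice A i f) (P-slice B i g) (P-slice C i h)
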